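{- Let $R\subseteq[n-1]$, and let $\upsilon\in U_R(n)$, $\eta\in UGC_R(n)$ and $\phi\in UF_R(n)$. (i) The $R$-cores $\Delta_R(\eta)$ and $\Delta_R(\phi)$ are gapless $R$-tuples, i.e. lie in $UG_R(n)$. (ii) $\Delta_R(\upsilon)\in UG_R(n)$ if and only if $\upsilon\in UGC_R(n)$. (iii) An $R$-tuple $\gamma\in UI_R(n)$ lies in $UG_R(n)$ if and only if the following holds for every $h\in[r]$: whenever $\gamma_{q_h}>\gamma_{q_h+1}$, setting $s:=\gamma_{q_h}-\gamma_{q_h+1}+1$, one has $s\le p_{h+1}$ and the first $s$ entries of the $(h+1)$-st carrel, $\gamma_{q_h+1},\dots,\gamma_{q_h+s}$, are $\gamma_{q_h}-s+1,\gamma_{q_h}-s+2,\dots,\gamma_{q_h}$.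
   Context: Fix $n\ge1$, $[n]=\{1,\dots,n\}$, and $R\subseteq[n-1]$ with elements $q_1<\dots<q_r$; set $q_0:=0$, $q_{r+1}:=n$. For $h\in[r+1]$ the $h$-th carrel is the integer interval $(q_{h-1},q_h]=\{q_{h-1}+1,\dots,q_h\}$, and $p_h:=q_h-q_{h-1}$. An $R$-tuple is an $n$-tuple $\nu=(\nu_1,\dots,\nu_n)$ with entries in $[n]$, considered together with these carrels. It is upper if $\nu_i\ge i$ for all $i$; $U_R(n)$ is the set of upper $R$-tuples. $UF_R(n)$ is the set of upper $R$-tuples that are weakly increasing (upper flags). $UI_R(n)$ is the set of upper $R$-tuples that are strictly increasing within each carrel. Critical list: for $\upsilon\in U_R(n)$ and $h\in[r+1]$, put $x_1:=q_h$; recursively, given $x_{u-1}$, let $x_u$ be the largest index with $q_{h-1}<x_u<x_{u-1}$ and $\upsilon_{x_{u-1}}-\upsilon_{x_u}>x_{u-1}-x_u$, if such exists, and stop otherwise. The indices $x_1>x_2>\dots$ so obtained are the critical indices of $\upsilon$ in carrel $h$, the pairs $(x_u,\upsilon_{x_u})$ are its critical pairs and the values $\upsilon_{x_u}$ its critical entries; the $R$-critical list of $\upsilon$ is the sequence over $h=1,\dots,r+1$ of these sets of critical pairs. $R$-core: $\Delta_R(\upsilon)=\delta$ where $\delta_i:=\upsilon_x-(x-i)$, with $x$ the smallest critical index of $\upsilon$ such that $x\ge i$ and $x$ lies in the same carrel as $i$. $UGC_R(n)$ (gapless core $R$-tuples) is the set of $\upsilon\in U_R(n)$ whose critical entries,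 listed in order of increasing critical index, form a weakly increasing sequence. $UG_R(n)$ (gapless $R$-tuples) is $UGC_R(n)\cap UI_R(n)$. -}

module Defs where

open import Data.Nat using (ℕ; zero; suc; _+_; _∸_; _≤_; _<_; _≤ᵇ_; _<ᵇ_)
open import Data.Bool using (Bool; true; false; if_then_else_)
open import Data.Maybe using (Maybe; just; nothing)
open import Data.List using (List; []; _∷_; length)
open import Data.List.Membership.Propositional using (_∈_)
open import Data.List.Relation.Unary.All using (All)
open import Data.List.Relation.Unary.Linked using (Linked)
open import Data.Product using (_×_; ∃-syntax)
open import Relation.Binary.PropositionalEquality using (_≡_)
open import Relation.Nullary using (¬_)

-- CONVENTIONS.
-- * R ⊆ [n-1] is given by the list qs = [q₁, …, q_r] of its elements in
--   increasing order (see ValidR).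
-- * An n-tuple ν is a function ℕ → ℕ, positions 1..n are meaningful
--   (ν i = ν_i); values at other positions are ignored by every predicate.

ValidR : ℕ → List ℕ → Set
ValidR n qs = Linked _<_ qs × All (λ q → 1 ≤ q × q < n) qs

-- q_h, with q_0 = 0 and q_{r+1} = n (and n for larger h).
Q : ℕ → List ℕ → ℕ → ℕ
Q n qs zero = 0
Q n [] (suc h) = n
Q n (q ∷ qs) (suc zero) = q
Q n (q ∷ qs) (suc (suc h)) = Q n qs (suc h)

P : ℕ → List ℕ → ℕ → ℕ
P n qs h = Q n qs h ∸ Q n qs (h ∸ 1)

Tuple : Set
Tuple = ℕ → ℕ

Upper : ℕ → Tuple → Set
Upper n ν = ∀ i → 1 ≤ i → i ≤ n → i ≤ ν i × ν i ≤ n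

UpperFlag : ℕ → Tuple → Set
UpperFlag n ν = Upper n ν × (∀ i → 1 ≤ i → suc i ≤ n → ν i ≤ ν (suc i))

-- UI_R(n): upper and strictly increasing within each carrel
-- (i and i+1 are in the same carrel iff i ∉ R).
UpperInc : ℕ → List ℕ → Tuple → Set
UpperInc n qs ν =
  Upper n ν × (∀ i → 1 ≤ i → suc i ≤ n → ¬ (i ∈ qs) → ν i < ν (suc i))

-- Criticality test: υ_y - υ_x > y - x  (for x < y), written in ℕ.
critTest : Tuple → ℕ → ℕ → Bool
critTest υ y x = (υ x + y) <ᵇ (υ y + x)

scan : Tuple → ℕ → ℕ → ℕ → Maybe ℕ
scan υ a y zero = nothing
scan υ a y (suc k) =
  if critTest υ y (a + suc k) then just (a + suc k) else scan υ a y k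

-- Critical indices x₁ = y > x₂ > … in the carrel (a, b], starting from y;
-- the fuel argument bounds the length (b steps are always enough).
critsFrom : Tuple → ℕ → ℕ → ℕ → List ℕ
critsFrom υ a y zero = y ∷ []
critsFrom υ a y (suc fuel) with scan υ a y (y ∸ suc a)
... | nothing = y ∷ []
... | just x  = y ∷ critsFrom υ a x fuel

crits : Tuple → ℕ → ℕ → List ℕ
crits υ a b = critsFrom υ a b b

Critical : ℕ → List ℕ → Tuple → ℕ → Set
Critical n qs υ x =
  ∃[ h ] (1 ≤ h × h ≤ suc (length qs)
          × x ∈ crits υ (Q n qs (h ∸ 1)) (Q n qs h))

GaplessCore : ℕ → List ℕ → Tuple → Set
GaplessCore n qs υ =
  Upper n υ × (∀ x y → Critical n qs υ x → Critical n qs υ y → x < y → υ x ≤ υ y)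

Gapless : ℕ → List ℕ → Tuple → Set
Gapless n qs υ = GaplessCore n qs υ × UpperInc n qs υ

carrelOf : ℕ → ℕ → List ℕ → ℕ → ℕ × ℕ
carrelOf n prev [] i = prev Data.Product., n
carrelOf n prev (q ∷ qs) i = if i ≤ᵇ q then (prev Data.Product., q) else carrelOf n q qs i

minGE : ℕ → ℕ → List ℕ → ℕ
minGE i d [] = d
minGE i d (x ∷ xs) = if i ≤ᵇ x then (if x ≤ᵇ minGE i d xs then x else minGE i d xs)
                                 else minGE i d xs

-- R-core Δ_R(υ): δ_i = υ_x - (x - i), x the smallest critical index ≥ i in
-- the carrel of i (the carrel's right end is always critical).
core : ℕ → List ℕ → Tuple → Tuple
core n qs υ i =
  let a = Data.Product.proj₁ (carrelOf n 0 qs i)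
      b = Data.Product.proj₂ (carrelOf n 0 qs i)
      x = minGE i b (crits υ a b)
  in υ x ∸ (x ∸ i)

BoundaryCond : ℕ → List ℕ → Tuple → Set
BoundaryCond n qs γ =
  ∀ h → 1 ≤ h → h ≤ length qs →
    let q = Q n qs h in
    γ (suc q) < γ q →
    let s = (γ q ∸ γ (suc q)) + 1 in
    s ≤ P n qs (suc h)
    × (∀ j → 1 ≤ j → j ≤ s → γ (q + j) ≡ (γ q ∸ s) + j)

module Submission where

-- Call υ i − i the drift of υ at i. The recursion defining the critical list finds exactly
-- the indices of a carrel whose drift is strictly below the drift at every later index of
-- the carrel. The core gives i the drift of the next critical index X(i) ≥ i; as the
-- drift increases along critical indices, the core is strictly increasing on each carrel,
-- agrees with υ at the critical indices and has the same critical indices as υ. This gives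
-- (ii), and (i) follows since a flag is weakly increasing. For (iii): where γ increases
-- strictly the drift increases weakly, so an index is critical exactly when γ jumps by at
-- least two after it or it ends its carrel. Critical entries then increase inside each
-- carrel, and γ is gapless iff every critical entry of carrel h+1 is at least γ_{q_h};
-- after a drop at q_h this says that carrel h+1 climbs back to γ_{q_h} by unit steps.

open import Defs
open import Data.Bool using (true; false)
open import Data.Empty using (⊥-elim)
open import Data.List using (List; []; _∷_; length)
open import Data.List.Membership.Propositional using (_∈_)
open import Data.List.Relation.Unary.Any using (here; there)
open import Data.List.Relation.Unary.All using (All) renaming (map to All-map)
open import Data.List.Relation.Unary.Linked using (Linked)
open import Data.Maybe using (Maybe; just; nothing)
open import Data.Nat
open import Data.Nat.Properties
open import Data.Nat.Tactic.RingSolver using (solve)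
open import Data.Product using (∃-syntax; _×_; _,_; proj₁; proj₂)
import Data.Product as Product
open import Data.Sum using (_⊎_; inj₁; inj₂)
import Data.Sum as Sum
open import Function.Base using (_∘_)
open import Function.Bundles using (_⇔_; mk⇔; Equivalence)
open import Relation.Binary.PropositionalEquality
open import Relation.Nullary using (¬_; Dec; yes; no; contradiction; ¬?; _×-dec_)
open import Relation.Nullary.Decidable using (decidable-stable)
open import Relation.Nullary.Reflects using (Reflects; ofʸ; ofⁿ)
open import Relation.Binary.Definitions using (tri<; tri≈; tri>)

infix 4 _≺[_]_ _≼[_]_

-- i ≺[ u ] j compares drifts, u i − i < u j − j, written without subtraction.
_≺[_]_ : ℕ → Tuple → ℕ → Set
i ≺[ u ] j = u i + j < u j + i

_≼[_]_ : ℕ → Tuple → ℕ → Set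
i ≼[ u ] j = u i + j ≤ u j + i

+-cross-≤-trans : ∀ a a' b b' c c' → a + b' ≤ b + a' → b + c' ≤ c + b' → a + c' ≤ c + a'
+-cross-≤-trans a a' b b' c c' p q = +-cancelʳ-≤ (b + b') (a + c') (c + a') (begin
  a + c' + (b + b')    ≡⟨ solve (a ∷ c' ∷ b ∷ b' ∷ []) ⟩
  (a + b') + (b + c')  ≤⟨ +-mono-≤ p q ⟩
  (b + a') + (c + b')  ≡⟨ solve (a' ∷ b ∷ c ∷ b' ∷ []) ⟩
  c + a' + (b + b')    ∎)
  where open ≤-Reasoning

module DriftOrder (u : Tuple) where

  ≼-trans : ∀ {i j k} → i ≼[ u ] j → j ≼[ u ] k → i ≼[ u ] k
  ≼-trans {i} {j} {k} = +-cross-≤-trans (u i) i (u j) j (u k) k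

  ≺-≼-trans : ∀ {i j k} → i ≺[ u ] j → j ≼[ u ] k → i ≺[ u ] k
  ≺-≼-trans {i} {j} {k} = +-cross-≤-trans (suc (u i)) i (u j) j (u k) k

  ≺⇒≼ : ∀ {i j} → i ≺[ u ] j → i ≼[ u ] j
  ≺⇒≼ = <⇒≤

  ≺-trans : ∀ {i j k} → i ≺[ u ] j → j ≺[ u ] k → i ≺[ u ] k
  ≺-trans p q = ≺-≼-trans p (≺⇒≼ q)

  ⊀⇒≽ : ∀ {i j} → ¬ i ≺[ u ] j → j ≼[ u ] i
  ⊀⇒≽ = ≮⇒≥

  _≺?_ : ∀ i j → Dec (i ≺[ u ] j)
  i ≺? j = suc (u i + j) ≤? u j + i

  critTest-reflects : ∀ y x → Reflects (x ≺[ u ] y) (critTest u y x)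
  critTest-reflects y x = <ᵇ-reflects-< (u x + y) (u y + x)

  ≺⇒< : ∀ {i j} → i ≤ j → i ≺[ u ] j → u i < u j
  ≺⇒< {i} {j} i≤j i≺j = +-cancelʳ-≤ j (suc (u i)) (u j) (≤-trans i≺j (+-monoʳ-≤ (u j) i≤j))

  ≼⇒≤ : ∀ {i j} → i ≤ j → i ≼[ u ] j → u i ≤ u j
  ≼⇒≤ {i} {j} i≤j i≼j = +-cancelʳ-≤ j (u i) (u j) (≤-trans i≼j (+-monoʳ-≤ (u j) i≤j))

  ≼-suc⁺ : ∀ {i} → u i < u (suc i) → i ≼[ u ] suc i
  ≼-suc⁺ {i} lt = subst (_≤ u (suc i) + i) (sym (+-suc (u i) i)) (+-monoˡ-≤ i lt)

  ≺-suc⁺ : ∀ {i} → suc (u i) < u (suc i) → i ≺[ u ] suc i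
  ≺-suc⁺ {i} lt = subst (_≤ u (suc i) + i) (cong suc (sym (+-suc (u i) i))) (+-monoˡ-≤ i lt)

  ≼-suc⁻ : ∀ {i} → i ≼[ u ] suc i → u i < u (suc i)
  ≼-suc⁻ {i} i≼1+i = +-cancelʳ-≤ i (suc (u i)) (u (suc i))
    (subst (_≤ u (suc i) + i) (+-suc (u i) i) i≼1+i)

  ≺-suc⁻ : ∀ {i} → i ≺[ u ] suc i → suc (u i) < u (suc i)
  ≺-suc⁻ {i} i≺1+i = +-cancelʳ-≤ i (suc (suc (u i))) (u (suc i))
    (subst (_≤ u (suc i) + i) (cong suc (+-suc (u i) i)) i≺1+i)

-- Critical indices of a carrel

record CriticalIn (u : Tuple) (a b x : ℕ) : Set where
  constructor critical
  field
    above  : a < x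
    within : x ≤ b
    rises  : ∀ {z} → x < z → z ≤ b → x ≺[ u ] z

open CriticalIn

end-critical : ∀ {u a b} → a < b → CriticalIn u a b b
end-critical a<b = critical a<b ≤-refl (λ b<z z≤b → contradiction z≤b (<⇒≱ b<z))

module Scan (u : Tuple) (a y : ℕ) where
  open DriftOrder u

  ScanResult : ℕ → Maybe ℕ → Set
  ScanResult k nothing  = ∀ {x} → a < x → x ≤ a + k → ¬ x ≺[ u ] y
  ScanResult k (just x) =
    a < x × x ≤ a + k × x ≺[ u ] y × (∀ {z} → x < z → z ≤ a + k → ¬ z ≺[ u ] y)

  private
    ≤-+-suc-split : ∀ {x k} → x ≤ a + suc k → x ≤ a + k ⊎ x ≡ a + suc k
    ≤-+-suc-split {x} {k} x≤ with m≤n⇒m<n∨m≡n x≤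
    ... | inj₁ x< = inj₁ (≤-pred (subst (x <_) (+-suc a k) x<))
    ... | inj₂ x≡ = inj₂ x≡

    widen : ∀ {k} m → ¬ (a + suc k) ≺[ u ] y → ScanResult k m → ScanResult (suc k) m
    widen {k} nothing ⊀ none a<x x≤ with ≤-+-suc-split x≤
    ... | inj₁ x≤a+k = none a<x x≤a+k
    ... | inj₂ refl  = ⊀
    widen {k} (just x) ⊀ (a<x , x≤a+k , x≺y , last) =
      a<x , ≤-trans x≤a+k (+-monoʳ-≤ a (n≤1+n k)) , x≺y , last′
      where
        last′ : ∀ {z} → x < z → z ≤ a + suc k → ¬ z ≺[ u ] y
        last′ x<z z≤ with ≤-+-suc-split z≤
        ... | inj₁ z≤a+k = last x<z z≤a+k
        ... | inj₂ refl  = ⊀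

  scan-result : ∀ k → ScanResult k (scan u a y k)
  scan-result zero a<x x≤a+0 = contradiction (subst (_ ≤_) (+-identityʳ a) x≤a+0) (<⇒≱ a<x)
  scan-result (suc k) with critTest u y (a + suc k) | critTest-reflects y (a + suc k)
  ... | true  | ofʸ top≺y =
    subst (a <_) (sym (+-suc a k)) (s≤s (m≤m+n a k)) , ≤-refl , top≺y ,
    λ top<z z≤top → contradiction z≤top (<⇒≱ top<z)
  ... | false | ofⁿ top⊀y = widen (scan u a y k) top⊀y (scan-result k)

module CriticalList (u : Tuple) (a b : ℕ) where
  open DriftOrder u
  open Scan u a using (scan-result)

  private
    scan-top< : ∀ {y} → a < y → a + (y ∸ suc a) < y
    scan-top< a<y = ≤-reflexive (m+[n∸m]≡n a<y)

    <⇒≤-scan-top : ∀ {y z} → a < y → z < y → z ≤ a + (y ∸ suc a)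
    <⇒≤-scan-top a<y z<y = ≤-pred (subst (_ <_) (sym (m+[n∸m]≡n a<y)) z<y)

    scan-critical : ∀ {y x} → CriticalIn u a b y → Scan.ScanResult u a y (y ∸ suc a) (just x) →
                    CriticalIn u a b x × x < y
    scan-critical {y} {x} cy (a<x , x≤ , x≺y , last) =
      critical a<x (≤-trans (<⇒≤ x<y) (within cy)) x≺ , x<y
      where
        x<y : x < y
        x<y = ≤-<-trans x≤ (scan-top< (above cy))
        x≺ : ∀ {z} → x < z → z ≤ b → x ≺[ u ] z
        x≺ {z} x<z z≤b with <-cmp z y
        ... | tri< z<y _ _ = ≺-≼-trans x≺y (⊀⇒≽ (last x<z (<⇒≤-scan-top (above cy) z<y)))
        ... | tri≈ _ refl _ = x≺y
        ... | tri> _ _ y<z = ≺-trans x≺y (rises cy y<z z≤b)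

  critsFrom-sound : ∀ fuel {y x} → CriticalIn u a b y → x ∈ critsFrom u a y fuel →
                    CriticalIn u a b x
  critsFrom-sound zero cy (here refl) = cy
  critsFrom-sound (suc fuel) {y} cy x∈
    with scan u a y (y ∸ suc a) | scan-result y (y ∸ suc a)
  ... | nothing | _ with x∈
  ...   | here refl = cy
  critsFrom-sound (suc fuel) cy x∈ | just x' | found with x∈
  ...   | here refl  = cy
  ...   | there x∈′ = critsFrom-sound fuel (proj₁ (scan-critical cy found)) x∈′

  critsFrom-complete : ∀ fuel {y x} → CriticalIn u a b y → y ∸ suc a ≤ fuel →
                       CriticalIn u a b x → x ≤ y → x ∈ critsFrom u a y fuel
  critsFrom-complete zero cy y≤1+a cx x≤y =
    here (≤-antisym x≤y (≤-trans (m∸n≡0⇒m≤n (n≤0⇒n≡0 y≤1+a)) (above cx)))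
  critsFrom-complete (suc fuel) {y} {x} cy fuel-ok cx x≤y
    with scan u a y (y ∸ suc a) | scan-result y (y ∸ suc a) | m≤n⇒m<n∨m≡n x≤y
  ... | nothing | _    | inj₂ refl = here refl
  ... | just _  | _    | inj₂ refl = here refl
  ... | nothing | none | inj₁ x<y =
    contradiction (rises cx x<y (within cy)) (none (above cx) (<⇒≤-scan-top (above cy) x<y))
  ... | just x' | found@(_ , _ , _ , last) | inj₁ x<y =
    there (critsFrom-complete fuel cx' fuel-ok′ cx x≤x')
    where
      cx' = proj₁ (scan-critical cy found)
      fuel-ok′ : x' ∸ suc a ≤ fuel
      fuel-ok′ = ≤-pred (<-≤-trans (∸-monoˡ-< (proj₂ (scan-critical cy found)) (above cx')) fuel-ok)
      x≤x' : x ≤ x'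
      x≤x' = ≮⇒≥ λ x'<x →
        last x'<x (<⇒≤-scan-top (above cy) x<y) (rises cx x<y (within cy))

  ∈-crits⁻ : ∀ {x} → a < b → x ∈ crits u a b → CriticalIn u a b x
  ∈-crits⁻ a<b = critsFrom-sound b (end-critical a<b)

  ∈-crits⁺ : ∀ {x} → CriticalIn u a b x → x ∈ crits u a b
  ∈-crits⁺ cx = critsFrom-complete b (end-critical (<-≤-trans (above cx) (within cx)))
                  (m∸n≤m b (suc a)) cx (within cx)

minGE-cases : ∀ i d xs → minGE i d xs ≡ d ⊎ (minGE i d xs ∈ xs × i ≤ minGE i d xs)
minGE-cases i d [] = inj₁ refl
minGE-cases i d (x ∷ xs) with i ≤ᵇ x | ≤ᵇ-reflects-≤ i x
... | false | _ = Sum.map₂ (Product.map₁ there) (minGE-cases i d xs)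
... | true  | ofʸ i≤x with x ≤ᵇ minGE i d xs
...   | true  = inj₂ (here refl , i≤x)
...   | false = Sum.map₂ (Product.map₁ there) (minGE-cases i d xs)

minGE-minimal : ∀ {i y} d xs → y ∈ xs → i ≤ y → minGE i d xs ≤ y
minGE-minimal {i} d (x ∷ xs) y∈ i≤y with i ≤ᵇ x | ≤ᵇ-reflects-≤ i x
minGE-minimal d (x ∷ xs) (here refl) i≤y | false | ofⁿ i≰x = contradiction i≤y i≰x
minGE-minimal d (x ∷ xs) (there y∈) i≤y  | false | _ = minGE-minimal d xs y∈ i≤y
... | true | _ with x ≤ᵇ minGE i d xs | ≤ᵇ-reflects-≤ x (minGE i d xs)
minGE-minimal d (x ∷ xs) (here refl) i≤y | true | _ | true  | _ = ≤-refl
minGE-minimal d (x ∷ xs) (there y∈) i≤y  | true | _ | true  | ofʸ x≤m =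
  ≤-trans x≤m (minGE-minimal d xs y∈ i≤y)
minGE-minimal d (x ∷ xs) (here refl) i≤y | true | _ | false | ofⁿ x≰m = <⇒≤ (≰⇒> x≰m)
minGE-minimal d (x ∷ xs) (there y∈) i≤y  | true | _ | false | _ = minGE-minimal d xs y∈ i≤y

module NextCritical (u : Tuple) {a b : ℕ} (a<b : a < b) where
  open DriftOrder u
  open CriticalList u a b

  next : ℕ → ℕ
  next i = minGE i b (crits u a b)

  next-critical : ∀ i → CriticalIn u a b (next i)
  next-critical i with minGE-cases i b (crits u a b)
  ... | inj₁ next≡b     = subst (CriticalIn u a b) (sym next≡b) (end-critical a<b)
  ... | inj₂ (next∈ , _) = ∈-crits⁻ a<b next∈

  ≤-next : ∀ {i} → i ≤ b → i ≤ next i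
  ≤-next {i} i≤b with minGE-cases i b (crits u a b)
  ... | inj₁ next≡b      = subst (i ≤_) (sym next≡b) i≤b
  ... | inj₂ (_ , i≤next) = i≤next

  next-minimal : ∀ {i c} → CriticalIn u a b c → i ≤ c → next i ≤ c
  next-minimal cc = minGE-minimal _ (crits u a b) (∈-crits⁺ cc)

  next-fixed : ∀ {x} → CriticalIn u a b x → next x ≡ x
  next-fixed cx = ≤-antisym (next-minimal cx ≤-refl) (≤-next (within cx))

  -- Follow drops of the drift to the right; an index with no later drop is critical.
  critical-≼-above : ∀ fuel {y} → a < y → y ≤ b → b ∸ y ≤ fuel →
                     ∃[ c ] CriticalIn u a b c × y ≤ c × c ≼[ u ] y
  critical-≼-above fuel {y} a<y y≤b fuel-ok
    with anyUpTo? (λ z → (y <? z) ×-dec ¬? (y ≺? z)) (suc b)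
  ... | no no-drop = y , critical a<y y≤b y≺ , ≤-refl , ≤-refl
    where
      y≺ : ∀ {z} → y < z → z ≤ b → y ≺[ u ] z
      y≺ {z} y<z z≤b = decidable-stable (y ≺? z) λ y⊀z → no-drop (z , s≤s z≤b , y<z , y⊀z)
  ... | yes (z , z<1+b , y<z , y⊀z) with fuel
  ...   | zero = contradiction (<-≤-trans y<z (≤-pred z<1+b))
                   (≤⇒≯ (m∸n≡0⇒m≤n (n≤0⇒n≡0 fuel-ok)))
  ...   | suc fuel′
    with critical-≼-above fuel′ (<-trans a<y y<z) (≤-pred z<1+b)
           (≤-pred (<-≤-trans (∸-monoʳ-< y<z (≤-pred z<1+b)) fuel-ok))
  ...     | c , cc , z≤c , c≼z = c , cc , ≤-trans (<⇒≤ y<z) z≤c , ≼-trans c≼z (⊀⇒≽ y⊀z)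

  next-≼ : ∀ {i y} → a < i → i ≤ y → y ≤ b → next i ≼[ u ] y
  next-≼ {i} {y} a<i i≤y y≤b
    with critical-≼-above b (<-≤-trans a<i i≤y) y≤b (m∸n≤m b y)
  ... | c , cc , y≤c , c≼y with m≤n⇒m<n∨m≡n (next-minimal cc (≤-trans i≤y y≤c))
  ...   | inj₁ next<c = ≼-trans (≺⇒≼ (rises (next-critical i) next<c (within cc))) c≼y
  ...   | inj₂ refl   = c≼y

-- The core on a carrel

SameDrift : Tuple → ℕ → Tuple → ℕ → Set
SameDrift δ i u x = δ i + x ≡ u x + i

+-diagonal-shift : ∀ k {P Q p q i j x y} → P + x ≡ p + i → Q + y ≡ q + j →
                   k + p + y ≤ q + x → k + P + j ≤ Q + i
+-diagonal-shift k {P} {Q} {p} {q} {i} {j} {x} {y} e₁ e₂ le = +-cancelʳ-≤ (x + y) _ _ (begin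
  k + P + j + (x + y)    ≡⟨ solve (k ∷ P ∷ j ∷ x ∷ y ∷ []) ⟩
  k + (P + x) + (j + y)  ≡⟨ cong (λ t → k + t + (j + y)) e₁ ⟩
  k + (p + i) + (j + y)  ≡⟨ solve (k ∷ p ∷ i ∷ j ∷ y ∷ []) ⟩
  k + p + y + (i + j)    ≤⟨ +-monoˡ-≤ (i + j) le ⟩
  q + x + (i + j)        ≡⟨ solve (q ∷ x ∷ i ∷ j ∷ []) ⟩
  (q + j) + (i + x)      ≡⟨ cong (_+ (i + x)) e₂ ⟨
  (Q + y) + (i + x)      ≡⟨ solve (Q ∷ y ∷ i ∷ x ∷ []) ⟩
  Q + i + (x + y)        ∎)
  where open ≤-Reasoning

module _ (δ u : Tuple) {i j x y : ℕ} (same-i : SameDrift δ i u x) (same-j : SameDrift δ j u y) where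

  SameDrift-≼ : x ≼[ u ] y → i ≼[ δ ] j
  SameDrift-≼ = +-diagonal-shift 0 {δ i} {δ j} {u x} {u y} same-i same-j

  SameDrift-≺ : x ≺[ u ] y → i ≺[ δ ] j
  SameDrift-≺ = +-diagonal-shift 1 {δ i} {δ j} {u x} {u y} same-i same-j

[m∸[n∸o]]+n≡m+o : ∀ m n o → o ≤ n → n ≤ m → (m ∸ (n ∸ o)) + n ≡ m + o
[m∸[n∸o]]+n≡m+o m n o o≤n n≤m = begin
  (m ∸ (n ∸ o)) + n            ≡⟨ cong (m ∸ (n ∸ o) +_) (m∸n+n≡m o≤n) ⟨
  (m ∸ (n ∸ o)) + (n ∸ o + o)  ≡⟨ +-assoc (m ∸ (n ∸ o)) (n ∸ o) o ⟨
  (m ∸ (n ∸ o)) + (n ∸ o) + o  ≡⟨ cong (_+ o) (m∸n+n≡m (≤-trans (m∸n≤m n o) n≤m)) ⟩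
  m + o                        ∎
  where open ≡-Reasoning

module CarrelCore (u : Tuple) {n a b : ℕ} (a<b : a < b)
    (upper : ∀ {j} → a < j → j ≤ b → j ≤ u j × u j ≤ n)
    (δ : Tuple)
    (δ-def : ∀ {i} → a < i → i ≤ b →
             δ i ≡ u (NextCritical.next u a<b i) ∸ (NextCritical.next u a<b i ∸ i)) where
  open DriftOrder u
  open NextCritical u a<b

  private
    next-upper : ∀ {i} → a < i → i ≤ b → next i ≤ u (next i) × u (next i) ≤ n
    next-upper {i} a<i i≤b = upper (<-≤-trans a<i (≤-next i≤b)) (within (next-critical i))

  δ-same-drift : ∀ {i} → a < i → i ≤ b → SameDrift δ i u (next i)
  δ-same-drift {i} a<i i≤b rewrite δ-def a<i i≤b =
    [m∸[n∸o]]+n≡m+o (u (next i)) (next i) i (≤-next i≤b) (proj₁ (next-upper a<i i≤b))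

  δ-upper : ∀ {i} → a < i → i ≤ b → i ≤ δ i × δ i ≤ n
  δ-upper {i} a<i i≤b = i≤δi , δi≤n
    where
      i≤δi : i ≤ δ i
      i≤δi = +-cancelʳ-≤ (next i) i (δ i) (begin
        i + next i        ≡⟨ +-comm i (next i) ⟩
        next i + i        ≤⟨ +-monoˡ-≤ i (proj₁ (next-upper a<i i≤b)) ⟩
        u (next i) + i    ≡⟨ δ-same-drift a<i i≤b ⟨
        δ i + next i      ∎)
        where open ≤-Reasoning
      δi≤n : δ i ≤ n
      δi≤n = subst (_≤ n) (sym (δ-def a<i i≤b))
               (≤-trans (m∸n≤m (u (next i)) (next i ∸ i)) (proj₂ (next-upper a<i i≤b)))

  δ-increasing : ∀ {i} → a < i → suc i ≤ b → δ i < δ (suc i)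
  δ-increasing {i} a<i 1+i≤b = DriftOrder.≼-suc⁻ δ
    (SameDrift-≼ δ u (δ-same-drift a<i (<⇒≤ 1+i≤b)) (δ-same-drift (<-trans a<i (n<1+n i)) 1+i≤b)
      (next-≼ a<i (<⇒≤ (≤-next 1+i≤b)) (within (next-critical (suc i)))))

  δ-at-critical : ∀ {x} → CriticalIn u a b x → δ x ≡ u x
  δ-at-critical {x} cx = begin
    δ x                        ≡⟨ δ-def (above cx) (within cx) ⟩
    u (next x) ∸ (next x ∸ x)  ≡⟨ cong (λ t → u t ∸ (t ∸ x)) (next-fixed cx) ⟩
    u x ∸ (x ∸ x)              ≡⟨ cong (u x ∸_) (n∸n≡0 x) ⟩
    u x                        ∎
    where open ≡-Reasoning

  critical-δ⁺ : ∀ {x} → CriticalIn u a b x → CriticalIn δ a b x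
  critical-δ⁺ {x} cx = critical (above cx) (within cx) λ {z} x<z z≤b →
    SameDrift-≺ δ u (cong (_+ x) (δ-at-critical cx)) (δ-same-drift (<-trans (above cx) x<z) z≤b)
      (rises cx (<-≤-trans x<z (≤-next z≤b)) (within (next-critical z)))

  critical-δ⁻ : ∀ {x} → CriticalIn δ a b x → CriticalIn u a b x
  critical-δ⁻ {x} cx with m≤n⇒m<n∨m≡n (≤-next (within cx))
  ... | inj₂ x≡next = subst (CriticalIn u a b) (sym x≡next) (next-critical x)
  ... | inj₁ x<next = contradiction
    (SameDrift-≺ u δ (sym (δ-same-drift (above cx) (within cx))) (cong (_+ y) (sym (δ-at-critical cy)))
       (rises cx x<next (within cy)))
    (<-irrefl refl)
    where
      y = next x
      cy = next-critical x

-- Strictly increasing carrels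

ClimbsBack : Tuple → ℕ → ℕ → Set
ClimbsBack γ q b = γ (suc q) < γ q → let s = (γ q ∸ γ (suc q)) + 1 in
  s ≤ b ∸ q × (∀ j → 1 ≤ j → j ≤ s → γ (q + j) ≡ (γ q ∸ s) + j)

[m∸n]+1≤m : ∀ {m n} → 1 ≤ n → n ≤ m → (m ∸ n) + 1 ≤ m
[m∸n]+1≤m {m} {n} 1≤n n≤m = ≤-trans (+-monoʳ-≤ (m ∸ n) 1≤n) (≤-reflexive (m∸n+n≡m n≤m))

m∸[[m∸n]+1]+[1+t]≡n+t : ∀ m n t → 1 ≤ n → n ≤ m → (m ∸ ((m ∸ n) + 1)) + suc t ≡ n + t
m∸[[m∸n]+1]+[1+t]≡n+t m (suc n) t _ n<m = begin
  (m ∸ ((m ∸ suc n) + 1)) + suc t  ≡⟨ cong (_+ suc t) (∸-+-assoc m (m ∸ suc n) 1) ⟨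
  (m ∸ (m ∸ suc n) ∸ 1) + suc t    ≡⟨ cong (λ k → (k ∸ 1) + suc t) (m∸[m∸n]≡n n<m) ⟩
  n + suc t                        ≡⟨ +-suc n t ⟩
  suc n + t                        ∎
  where open ≡-Reasoning

Dominated : Tuple → ℕ → ℕ → Set
Dominated γ q b = ∀ {z} → CriticalIn γ q b z → γ q ≤ γ z

module IncreasingCarrel (γ : Tuple) {q b : ℕ} (q<b : q < b)
    (increasing : ∀ {i} → q < i → suc i ≤ b → γ i < γ (suc i)) where
  open DriftOrder γ

  ≼-within : ∀ {j m} → q < j → j ≤ m → m ≤ b → j ≼[ γ ] m
  ≼-within {j} {m} q<j j≤m m≤b with m≤n⇒m<n∨m≡n j≤m
  ... | inj₂ refl = ≤-refl
  ≼-within {j} {suc m} q<j j≤1+m 1+m≤b | inj₁ j<1+m =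
    ≼-trans (≼-within q<j (≤-pred j<1+m) (<⇒≤ 1+m≤b))
            (≼-suc⁺ (increasing (<-≤-trans q<j (≤-pred j<1+m)) 1+m≤b))

  ≤-within : ∀ {j m} → q < j → j ≤ m → m ≤ b → γ j ≤ γ m
  ≤-within q<j j≤m m≤b = ≼⇒≤ j≤m (≼-within q<j j≤m m≤b)

  jump⇒critical : ∀ {x} → q < x → suc x ≤ b → suc (γ x) < γ (suc x) → CriticalIn γ q b x
  jump⇒critical {x} q<x 1+x≤b jump = critical q<x (<⇒≤ 1+x≤b) λ x<z z≤b →
    ≺-≼-trans (≺-suc⁺ jump) (≼-within (<-trans q<x (n<1+n x)) x<z z≤b)

  non-critical-step : ∀ {m} → q < m → suc m ≤ b → ¬ CriticalIn γ q b m → γ (suc m) ≡ suc (γ m)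
  non-critical-step q<m 1+m≤b not-critical with m≤n⇒m<n∨m≡n (increasing q<m 1+m≤b)
  ... | inj₁ jump = contradiction (jump⇒critical q<m 1+m≤b jump) not-critical
  ... | inj₂ step = sym step

  critical⇒jump : ∀ {x} → CriticalIn γ q b x → suc x ≤ b → suc (γ x) < γ (suc x)
  critical⇒jump cx 1+x≤b = ≺-suc⁻ (rises cx (n<1+n _) 1+x≤b)

  dominated-run : Dominated γ q b → γ (suc q) < γ q → ∀ t → t ≤ γ q ∸ γ (suc q) →
                  q + suc t ≤ b × γ (q + suc t) ≡ γ (suc q) + t
  dominated-run dominated drop zero _ =
    subst (_≤ b) (+-comm 1 q) q<b , trans (cong γ (+-comm q 1)) (sym (+-identityʳ _))
  dominated-run dominated drop (suc t) 1+t≤g∸c with dominated-run dominated drop t (<⇒≤ 1+t≤g∸c)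
  ... | m≤b , γm≡c+t = subst (_≤ b) (sym (+-suc q (suc t))) m<b , (begin
      γ (q + suc (suc t))  ≡⟨ cong γ (+-suc q (suc t)) ⟩
      γ (suc m)            ≡⟨ non-critical-step q<m m<b not-critical ⟩
      suc (γ m)            ≡⟨ cong suc γm≡c+t ⟩
      suc (c + t)          ≡⟨ +-suc c t ⟨
      c + suc t            ∎)
    where
      open ≡-Reasoning
      c = γ (suc q)
      m = q + suc t
      q<m : q < m
      q<m = subst (q <_) (sym (+-suc q t)) (s≤s (m≤m+n q t))
      γm<γq : γ m < γ q
      γm<γq = subst (_< γ q) (sym γm≡c+t) (subst (_≤ γ q) (cong suc (+-comm t c))
                (m≤o∸n⇒m+n≤o (suc t) (<⇒≤ drop) 1+t≤g∸c))
      not-critical : ¬ CriticalIn γ q b m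
      not-critical cm = <⇒≱ γm<γq (dominated cm)
      m<b : m < b
      m<b with m≤n⇒m<n∨m≡n m≤b
      ... | inj₁ m<b = m<b
      ... | inj₂ refl = contradiction (end-critical q<b) not-critical

  module _ (1≤γ[1+q] : 1 ≤ γ (suc q)) where

    dominated⇒climbsBack : Dominated γ q b → ClimbsBack γ q b
    dominated⇒climbsBack dominated drop = s≤b∸q , run-values
      where
        g = γ q
        c = γ (suc q)
        run = dominated-run dominated drop
        s≤b∸q : (g ∸ c) + 1 ≤ b ∸ q
        s≤b∸q = m+n≤o⇒m≤o∸n ((g ∸ c) + 1) (subst (_≤ b)
          (trans (cong (q +_) (+-comm 1 (g ∸ c))) (+-comm q _)) (proj₁ (run (g ∸ c) ≤-refl)))
        run-values : ∀ j → 1 ≤ j → j ≤ (g ∸ c) + 1 → γ (q + j) ≡ (g ∸ ((g ∸ c) + 1)) + j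
        run-values (suc t) _ 1+t≤s =
          trans (proj₂ (run t (≤-pred (subst (suc t ≤_) (+-comm (g ∸ c) 1) 1+t≤s))))
                (sym (m∸[[m∸n]+1]+[1+t]≡n+t g c t 1≤γ[1+q] (<⇒≤ drop)))

    climbsBack⇒dominated : ClimbsBack γ q b → Dominated γ q b
    climbsBack⇒dominated climbs {z} cz with γ (suc q) <? γ q
    ... | no no-drop = ≤-trans (≮⇒≥ no-drop) (≤-within (n<1+n q) (above cz) (within cz))
    ... | yes drop = run-dominates (climbs drop)
      where
        g = γ q
        s = (g ∸ γ (suc q)) + 1
        run-dominates : s ≤ b ∸ q × (∀ j → 1 ≤ j → j ≤ s → γ (q + j) ≡ (g ∸ s) + j) → g ≤ γ z
        run-dominates (s≤b∸q , run) with q + s ≤? z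
        ... | yes q+s≤z = subst (_≤ γ z) γ[q+s]≡g (≤-within q<q+s q+s≤z (within cz))
          where
            q<q+s : q < q + s
            q<q+s = subst (_≤ q + s) (+-comm q 1) (+-monoʳ-≤ q (m≤n+m 1 (g ∸ γ (suc q))))
            γ[q+s]≡g : γ (q + s) ≡ g
            γ[q+s]≡g = trans (run s (m≤n+m 1 _) ≤-refl) (m∸n+n≡m ([m∸n]+1≤m 1≤γ[1+q] (<⇒≤ drop)))
        ... | no q+s≰z = ⊥-elim (<-irrefl refl (subst (suc (γ z) <_) γ[1+z]≡1+γz (critical⇒jump cz 1+z≤b)))
          where
            open ≡-Reasoning
            j = z ∸ q
            q+j≡z : q + j ≡ z
            q+j≡z = m+[n∸m]≡n (<⇒≤ (above cz))
            q+[1+j]≡1+z : q + suc j ≡ suc z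
            q+[1+j]≡1+z = trans (+-suc q j) (cong suc q+j≡z)
            1+j≤s : suc j ≤ s
            1+j≤s = +-cancelˡ-≤ q (suc j) s (subst (_≤ q + s) (sym q+[1+j]≡1+z) (≰⇒> q+s≰z))
            1+z≤b : suc z ≤ b
            1+z≤b = ≤-trans (≰⇒> q+s≰z) (subst (q + s ≤_) (m+[n∸m]≡n (<⇒≤ q<b)) (+-monoʳ-≤ q s≤b∸q))
            γ[1+z]≡1+γz : γ (suc z) ≡ suc (γ z)
            γ[1+z]≡1+γz = begin
              γ (suc z)            ≡⟨ cong γ q+[1+j]≡1+z ⟨
              γ (q + suc j)        ≡⟨ run (suc j) (s≤s z≤n) 1+j≤s ⟩
              (g ∸ s) + suc j      ≡⟨ +-suc (g ∸ s) j ⟩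
              suc ((g ∸ s) + j)    ≡⟨ cong suc (run j (m<n⇒0<n∸m (above cz)) (<⇒≤ 1+j≤s)) ⟨
              suc (γ (q + j))      ≡⟨ cong (suc ∘ γ) q+j≡z ⟩
              suc (γ z)            ∎

-- The whole tuple

-- The carrel boundaries q_0 < q_1 < … < q_{r+1}, with q_0 = p in place of 0 so that they
-- can be computed by recursion on the list of the q_h.
boundary : ℕ → ℕ → List ℕ → ℕ → ℕ
boundary n p qs       zero    = p
boundary n p []       (suc h) = n
boundary n p (q ∷ qs) (suc h) = boundary n q qs h

Q≡boundary : ∀ n qs h → Q n qs h ≡ boundary n 0 qs h
Q≡boundary n qs       zero          = refl
Q≡boundary n []       (suc h)       = refl
Q≡boundary n (q ∷ qs) (suc zero)    = refl
Q≡boundary n (q ∷ qs) (suc (suc h)) = trans (Q≡boundary n qs (suc h)) (start-irrelevant qs)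
  where
    start-irrelevant : ∀ qs → boundary n 0 qs (suc h) ≡ boundary n q qs (suc h)
    start-irrelevant []      = refl
    start-irrelevant (_ ∷ _) = refl

module Boundaries (n : ℕ) where
  -- Opened only here: an overloaded _∷_ makes the list arguments of solve ambiguous.
  open import Data.List.Relation.Unary.All using (_∷_)
  open import Data.List.Relation.Unary.Linked using ([-]; _∷_; tail)

  boundary-< : ∀ {p qs} → Linked _<_ (p ∷ qs) → All (_< n) qs → p < n →
               ∀ h → h ≤ length qs → boundary n p qs h < boundary n p qs (suc h)
  boundary-< {qs = []}    _          _          p<n zero    _         = p<n
  boundary-< {qs = _ ∷ _} (p<q ∷ _)  _          _   zero    _         = p<q
  boundary-< {qs = _ ∷ _} (_ ∷ lk)   (q<n ∷ al) _   (suc h) (s≤s h≤r) = boundary-< lk al q<n h h≤r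

  boundary-last : ∀ p qs → boundary n p qs (suc (length qs)) ≡ n
  boundary-last p []       = refl
  boundary-last p (q ∷ qs) = boundary-last q qs

  boundary-∈ : ∀ p qs h → 1 ≤ h → h ≤ length qs → boundary n p qs h ∈ qs
  boundary-∈ p (q ∷ qs) (suc zero)    _ _         = here refl
  boundary-∈ p (q ∷ qs) (suc (suc h)) _ (s≤s h≤r) = there (boundary-∈ q qs (suc h) (s≤s z≤n) h≤r)

  ∈⇒boundary : ∀ p qs {x} → x ∈ qs → ∃[ h ] 1 ≤ h × h ≤ length qs × x ≡ boundary n p qs h
  ∈⇒boundary p (q ∷ qs) (here refl) = 1 , ≤-refl , s≤s z≤n , refl
  ∈⇒boundary p (q ∷ qs) (there x∈) with ∈⇒boundary q qs x∈
  ... | h , 1≤h , h≤r , x≡ = suc h , s≤s z≤n , s≤s h≤r , x≡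

  0∷-linked : ∀ {qs} → Linked _<_ qs → All (λ q → 1 ≤ q × q < n) qs → Linked _<_ (0 ∷ qs)
  0∷-linked {[]}    _  _                = [-]
  0∷-linked {_ ∷ _} lk ((1≤q , _) ∷ _) = 1≤q ∷ lk

  carrelOf-boundary : ∀ p qs → Linked _<_ (p ∷ qs) → ∀ {i} → p < i → i ≤ n →
    ∃[ h ] h ≤ length qs × boundary n p qs h < i × i ≤ boundary n p qs (suc h)
           × carrelOf n p qs i ≡ (boundary n p qs h , boundary n p qs (suc h))
  carrelOf-boundary p []       _  p<i i≤n = 0 , z≤n , p<i , i≤n , refl
  carrelOf-boundary p (q ∷ qs) lk {i} p<i i≤n with i ≤ᵇ q | ≤ᵇ-reflects-≤ i q
  ... | true  | ofʸ i≤q = 0 , z≤n , p<i , i≤q , refl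
  ... | false | ofⁿ i≰q with carrelOf-boundary q qs (tail lk) (≰⇒> i≰q) i≤n
  ...   | h , h≤r , below , above′ , carrel≡ = suc h , s≤s h≤r , below , above′ , carrel≡

upperFlag-mono : ∀ {n φ i j} → UpperFlag n φ → 1 ≤ i → i ≤ j → j ≤ n → φ i ≤ φ j
upperFlag-mono flag 1≤i i≤j j≤n with m≤n⇒m<n∨m≡n i≤j
... | inj₂ refl = ≤-refl
upperFlag-mono {j = suc j} flag 1≤i _ 1+j≤n | inj₁ i<1+j =
  ≤-trans (upperFlag-mono flag 1≤i (≤-pred i<1+j) (<⇒≤ 1+j≤n)) (proj₂ flag j (≤-trans 1≤i (≤-pred i<1+j)) 1+j≤n)

module Carrels (n : ℕ) (qs : List ℕ) (1≤n : 1 ≤ n) (valid : ValidR n qs) where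
  open Boundaries n

  r : ℕ
  r = length qs

  g : ℕ → ℕ
  g = boundary n 0 qs

  private
    0∷qs-linked : Linked _<_ (0 ∷ qs)
    0∷qs-linked = 0∷-linked (proj₁ valid) (proj₂ valid)

  g-< : ∀ k → k ≤ r → g k < g (suc k)
  g-< = boundary-< 0∷qs-linked (All-map proj₂ (proj₂ valid)) 1≤n

  g-mono : ∀ {k k'} → k ≤ k' → k' ≤ suc r → g k ≤ g k'
  g-mono k≤k' k'≤1+r with m≤n⇒m<n∨m≡n k≤k'
  ... | inj₂ refl = ≤-refl
  g-mono {k} {suc k'} _ 1+k'≤1+r | inj₁ k<1+k' =
    ≤-trans (g-mono (≤-pred k<1+k') (m≤n⇒m≤1+n (≤-pred 1+k'≤1+r))) (<⇒≤ (g-< k' (≤-pred 1+k'≤1+r)))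

  g≤n : ∀ k → k ≤ r → g (suc k) ≤ n
  g≤n k k≤r = subst (g (suc k) ≤_) (boundary-last 0 qs) (g-mono (s≤s k≤r) ≤-refl)

  InCarrel : ℕ → ℕ → Set
  InCarrel k i = k ≤ r × g k < i × i ≤ g (suc k)

  carrel-of : ∀ {i} → 1 ≤ i → i ≤ n → ∃[ k ] InCarrel k i
  carrel-of 1≤i i≤n with carrelOf-boundary 0 qs 0∷qs-linked 1≤i i≤n
  ... | k , k≤r , below , above′ , _ = k , k≤r , below , above′

  carrel-unique : ∀ {k k' i} → InCarrel k i → InCarrel k' i → k ≡ k'
  carrel-unique {k} {k'} (k≤r , gk<i , i≤g[1+k]) (k'≤r , gk'<i , i≤g[1+k']) with <-cmp k k'
  ... | tri≈ _ k≡k' _ = k≡k'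
  ... | tri< k<k' _ _ = contradiction (≤-trans i≤g[1+k] (g-mono k<k' (m≤n⇒m≤1+n k'≤r))) (<⇒≱ gk'<i)
  ... | tri> _ _ k'<k = contradiction (≤-trans i≤g[1+k'] (g-mono k'<k (m≤n⇒m≤1+n k≤r))) (<⇒≱ gk<i)

  carrelOf-InCarrel : ∀ {k i} → InCarrel k i → carrelOf n 0 qs i ≡ (g k , g (suc k))
  carrelOf-InCarrel {k} in-k@(k≤r , gk<i , i≤g[1+k])
    with carrelOf-boundary 0 qs 0∷qs-linked (≤-trans (s≤s z≤n) gk<i) (≤-trans i≤g[1+k] (g≤n k k≤r))
  ... | k' , k'≤r , below , above′ , carrel≡ rewrite carrel-unique in-k (k'≤r , below , above′) = carrel≡

  ∉R⇒interior : ∀ {k i} → ¬ i ∈ qs → suc i ≤ n → InCarrel k i → suc i ≤ g (suc k)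
  ∉R⇒interior {k} {i} i∉R 1+i≤n (k≤r , _ , i≤g[1+k]) with m≤n⇒m<n∨m≡n i≤g[1+k]
  ... | inj₁ i<g[1+k] = i<g[1+k]
  ... | inj₂ i≡g[1+k] with m≤n⇒m<n∨m≡n k≤r
  ...   | inj₁ k<r  = contradiction (subst (_∈ qs) (sym i≡g[1+k]) (boundary-∈ 0 qs (suc k) (s≤s z≤n) k<r)) i∉R
  ...   | inj₂ refl = contradiction (trans i≡g[1+k] (boundary-last 0 qs)) (<⇒≢ 1+i≤n)

  interior⇒∉R : ∀ {k i} → InCarrel k i → suc i ≤ g (suc k) → ¬ i ∈ qs
  interior⇒∉R {k} (k≤r , gk<i , _) 1+i≤g[1+k] i∈R with ∈⇒boundary 0 qs i∈R
  ... | h , _ , h≤r , refl = <-irrefl refl (<-≤-trans k<h (≤-pred h<1+k))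
    where
      k<h : k < h
      k<h = ≰⇒> λ h≤k → <⇒≱ gk<i (g-mono h≤k (m≤n⇒m≤1+n k≤r))
      h<1+k : h < suc k
      h<1+k = ≰⇒> λ 1+k≤h → <⇒≱ 1+i≤g[1+k] (g-mono 1+k≤h (m≤n⇒m≤1+n h≤r))

  Critical⇒carrel : ∀ {u x} → Critical n qs u x → ∃[ k ] k ≤ r × CriticalIn u (g k) (g (suc k)) x
  Critical⇒carrel {u} {x} (suc k , _ , s≤s k≤r , x∈) = k , k≤r ,
    CriticalList.∈-crits⁻ u (g k) (g (suc k)) (g-< k k≤r)
      (subst₂ (λ a b → x ∈ crits u a b) (Q≡boundary n qs k) (Q≡boundary n qs (suc k)) x∈)

  carrel⇒Critical : ∀ {u x k} → k ≤ r → CriticalIn u (g k) (g (suc k)) x → Critical n qs u x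
  carrel⇒Critical {u} {x} {k} k≤r cx = suc k , s≤s z≤n , s≤s k≤r ,
    subst₂ (λ a b → x ∈ crits u a b) (sym (Q≡boundary n qs k)) (sym (Q≡boundary n qs (suc k)))
      (CriticalList.∈-crits⁺ u (g k) (g (suc k)) cx)

  Critical⇒range : ∀ {u x} → Critical n qs u x → 1 ≤ x × x ≤ n
  Critical⇒range cx with Critical⇒carrel cx
  ... | k , k≤r , cx′ = ≤-trans (s≤s z≤n) (above cx′) , ≤-trans (within cx′) (g≤n k k≤r)

  upperFlag⇒gaplessCore : ∀ {φ} → UpperFlag n φ → GaplessCore n qs φ
  upperFlag⇒gaplessCore flag = proj₁ flag , λ x y cx cy x<y →
    upperFlag-mono flag (proj₁ (Critical⇒range cx)) (<⇒≤ x<y) (proj₂ (Critical⇒range cy))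

  core-def : ∀ υ {k i} (in-k : InCarrel k i) →
             let x = NextCritical.next υ (g-< k (proj₁ in-k)) i in core n qs υ i ≡ υ x ∸ (x ∸ i)
  core-def υ {i = i} in-k = cong (λ (a , b) → let x = minGE i b (crits υ a b) in υ x ∸ (x ∸ i))
                                 (carrelOf-InCarrel in-k)

  module Core (υ : Tuple) (υ-upper : Upper n υ) where

    δ : Tuple
    δ = core n qs υ

    module In (k : ℕ) (k≤r : k ≤ r) = CarrelCore υ (g-< k k≤r)
      (λ gk<j j≤g[1+k] → υ-upper _ (≤-trans (s≤s z≤n) gk<j) (≤-trans j≤g[1+k] (g≤n k k≤r)))
      δ (λ gk<i i≤g[1+k] → core-def υ (k≤r , gk<i , i≤g[1+k]))

    core-upperInc : UpperInc n qs δ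
    core-upperInc = upper , increasing
      where
        upper : Upper n δ
        upper i 1≤i i≤n with carrel-of 1≤i i≤n
        ... | k , k≤r , gk<i , i≤g[1+k] = In.δ-upper k k≤r gk<i i≤g[1+k]
        increasing : ∀ i → 1 ≤ i → suc i ≤ n → ¬ i ∈ qs → δ i < δ (suc i)
        increasing i 1≤i 1+i≤n i∉R with carrel-of 1≤i (<⇒≤ 1+i≤n)
        ... | k , in-k@(k≤r , gk<i , _) = In.δ-increasing k k≤r gk<i (∉R⇒interior i∉R 1+i≤n in-k)

    core-critical⁺ : ∀ {x} → Critical n qs υ x → Critical n qs δ x
    core-critical⁺ cx with Critical⇒carrel cx
    ... | k , k≤r , cx′ = carrel⇒Critical k≤r (In.critical-δ⁺ k k≤r cx′)

    core-critical⁻ : ∀ {x} → Critical n qs δ x → Critical n qs υ x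
    core-critical⁻ cx with Critical⇒carrel cx
    ... | k , k≤r , cx′ = carrel⇒Critical k≤r (In.critical-δ⁻ k k≤r cx′)

    core-at-critical : ∀ {x} → Critical n qs υ x → δ x ≡ υ x
    core-at-critical cx with Critical⇒carrel cx
    ... | k , k≤r , cx′ = In.δ-at-critical k k≤r cx′

    core-gapless⇔ : Gapless n qs δ ⇔ GaplessCore n qs υ
    core-gapless⇔ = mk⇔ to from
      where
        to : Gapless n qs δ → GaplessCore n qs υ
        to ((_ , δ-gapless) , _) = υ-upper , λ x y cx cy x<y →
          subst₂ _≤_ (core-at-critical cx) (core-at-critical cy)
            (δ-gapless x y (core-critical⁺ cx) (core-critical⁺ cy) x<y)
        from : GaplessCore n qs υ → Gapless n qs δ
        from (_ , υ-gapless) = (proj₁ core-upperInc , λ x y cx cy x<y →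
          subst₂ _≤_ (sym (core-at-critical (core-critical⁻ cx))) (sym (core-at-critical (core-critical⁻ cy)))
            (υ-gapless x y (core-critical⁻ cx) (core-critical⁻ cy) x<y)) , core-upperInc

  module Increasing (γ : Tuple) (γ-inc : UpperInc n qs γ) where
    open DriftOrder γ

    increasing-in : ∀ k → k ≤ r → ∀ {i} → g k < i → suc i ≤ g (suc k) → γ i < γ (suc i)
    increasing-in k k≤r {i} gk<i 1+i≤g[1+k] =
      proj₂ γ-inc i (≤-trans (s≤s z≤n) gk<i) (≤-trans 1+i≤g[1+k] (g≤n k k≤r))
        (interior⇒∉R (k≤r , gk<i , <⇒≤ 1+i≤g[1+k]) 1+i≤g[1+k])

    module In (k : ℕ) (k≤r : k ≤ r) = IncreasingCarrel γ (g-< k k≤r) (increasing-in k k≤r)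

    DominatedAtBoundaries : Set
    DominatedAtBoundaries = ∀ k → suc k ≤ r → Dominated γ (g (suc k)) (g (suc (suc k)))

    gapless⇒dominated : GaplessCore n qs γ → DominatedAtBoundaries
    gapless⇒dominated (_ , gapless) k 1+k≤r cz = gapless _ _
      (carrel⇒Critical (≤-trans (n≤1+n k) 1+k≤r) (end-critical (g-< k (≤-trans (n≤1+n k) 1+k≤r))))
      (carrel⇒Critical 1+k≤r cz) (above cz)

    boundary-values-mono : DominatedAtBoundaries → ∀ {h h'} → 1 ≤ h → h ≤ h' → h' ≤ r → γ (g h) ≤ γ (g h')
    boundary-values-mono dom 1≤h h≤h' h'≤r with m≤n⇒m<n∨m≡n h≤h'
    ... | inj₂ refl = ≤-refl
    boundary-values-mono dom {h} {suc (suc k)} 1≤h _ 2+k≤r | inj₁ h<2+k =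
      ≤-trans (boundary-values-mono dom 1≤h (≤-pred h<2+k) 1+k≤r) (dom k 1+k≤r (end-critical (g-< (suc k) 1+k≤r)))
      where 1+k≤r = ≤-trans (n≤1+n _) 2+k≤r
    boundary-values-mono dom {suc h} {suc zero} _ _ _ | inj₁ (s≤s ())

    dominated⇒gapless : DominatedAtBoundaries → GaplessCore n qs γ
    dominated⇒gapless dom = proj₁ γ-inc , λ x y cx cy x<y → compare-critical (Critical⇒carrel cx) (Critical⇒carrel cy) x<y
      where
        compare-critical : ∀ {x y} → ∃[ k ] k ≤ r × CriticalIn γ (g k) (g (suc k)) x →
                  ∃[ k ] k ≤ r × CriticalIn γ (g k) (g (suc k)) y → x < y → γ x ≤ γ y
        compare-critical (k₁ , k₁≤r , cx) (k₂ , k₂≤r , cy) x<y with <-cmp k₁ k₂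
        ... | tri≈ _ refl _ = <⇒≤ (≺⇒< (<⇒≤ x<y) (rises cx x<y (within cy)))
        ... | tri> _ _ k₂<k₁ = contradiction
          (≤-trans (within cy) (≤-trans (g-mono k₂<k₁ (m≤n⇒m≤1+n k₁≤r)) (<⇒≤ (above cx)))) (<⇒≱ x<y)
        compare-critical {x} {y} (k₁ , k₁≤r , cx) (suc k , 1+k≤r , cy) x<y | tri< k₁<1+k _ _ = begin
          γ x              ≤⟨ In.≤-within k₁ k₁≤r (above cx) (within cx) ≤-refl ⟩
          γ (g (suc k₁))   ≤⟨ boundary-values-mono dom (s≤s z≤n) k₁<1+k 1+k≤r ⟩
          γ (g (suc k))    ≤⟨ dom k 1+k≤r cy ⟩
          γ y              ∎
          where open ≤-Reasoning

    boundaryCond⇔dominated : BoundaryCond n qs γ ⇔ DominatedAtBoundaries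
    boundaryCond⇔dominated = mk⇔ to from
      where
        Q≡g : ∀ k → Q n qs k ≡ g k
        Q≡g = Q≡boundary n qs
        1≤γ[1+g] : ∀ k → suc k ≤ r → 1 ≤ γ (suc (g (suc k)))
        1≤γ[1+g] k 1+k≤r = ≤-trans (s≤s z≤n)
          (proj₁ (proj₁ γ-inc (suc (g (suc k))) (s≤s z≤n) (≤-trans (g-< (suc k) 1+k≤r) (g≤n (suc k) 1+k≤r))))
        to : BoundaryCond n qs γ → DominatedAtBoundaries
        to bc k 1+k≤r = In.climbsBack⇒dominated (suc k) 1+k≤r (1≤γ[1+g] k 1+k≤r)
          (subst₂ (ClimbsBack γ) (Q≡g (suc k)) (Q≡g (suc (suc k))) (bc (suc k) (s≤s z≤n) 1+k≤r))
        from : DominatedAtBoundaries → BoundaryCond n qs γ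
        from dom (suc k) _ 1+k≤r = subst₂ (ClimbsBack γ) (sym (Q≡g (suc k))) (sym (Q≡g (suc (suc k))))
          (In.dominated⇒climbsBack (suc k) 1+k≤r (1≤γ[1+g] k 1+k≤r) (dom k 1+k≤r))

    gapless⇔boundaryCond : Gapless n qs γ ⇔ BoundaryCond n qs γ
    gapless⇔boundaryCond = mk⇔
      (λ (γ-gapless , _) → Equivalence.from boundaryCond⇔dominated (gapless⇒dominated γ-gapless))
      (λ bc → dominated⇒gapless (Equivalence.to boundaryCond⇔dominated bc) , γ-inc)

proposition4p2 : (n : ℕ) (qs : List ℕ) → 1 ≤ n → ValidR n qs →
    ((η : Tuple) → GaplessCore n qs η → Gapless n qs (core n qs η))
    × ((φ : Tuple) → UpperFlag n φ → Gapless n qs (core n qs φ))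
    × ((υ : Tuple) → Upper n υ → (Gapless n qs (core n qs υ) ⇔ GaplessCore n qs υ))
    × ((γ : Tuple) → UpperInc n qs γ → (Gapless n qs γ ⇔ BoundaryCond n qs γ))
proposition4p2 n qs 1≤n valid =
    (λ η η-gapless → Equivalence.from (core-gapless⇔ η (proj₁ η-gapless)) η-gapless)
  , (λ φ φ-flag → Equivalence.from (core-gapless⇔ φ (proj₁ φ-flag)) (upperFlag⇒gaplessCore φ-flag))
  , core-gapless⇔
  , gapless⇔boundaryCond
  where
    open Carrels n qs 1≤n valid
    open Core using (core-gapless⇔)
    open Increasing using (gapless⇔boundaryCond)
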